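{- Let $T$ be a $\Delta(1,2,2)$-free tournament, let $v\in V(T)$, and let $S$ be a $\Delta(1,2,2)$-free tournament with at least two vertices. Then the tournament obtained from $T$ by substituting $S$ for $v$ is $\Delta(1,2,2)$-free if and only if $v$ is nice in $T$.
   Context: Tournaments are finite; $T$ is $S$-free if no induced subtournament is isomorphic to $S$. $X\Rightarrow Y$ means all edges between disjoint $X,Y$ go from $X$ to $Y$. $\Delta(1,2,2)$: vertices $x,y_1,y_2,z_1,z_2$ with $x\Rightarrow\{y_1,y_2\}\Rightarrow\{z_1,z_2\}\Rightarrow x$ and edges $y_1y_2,z_1z_2$. A vertex $v$ of $T$ is nice if there are no three distinct vertices $x,y_1,y_2$ of $T$ such that both $\{v,x,y_1\}$ and $\{v,x,y_2\}$ induce cyclic triangles. Substituting $S$ for $v$ in $T$: the resulting tournament has vertex set $(V(T)\setminus\{v\})\cup V(S)$ (disjoint), induces $T\setminus v$ on $V(T)\setminus\{v\}$ and $S$ on $V(S)$, and for $x_1\in V(T)\setminus\{v\}$, $x_2\in V(S)$ the edge goes from $x_1$ to $x_2$ iff $x_1v\in E(T)$. -}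

module Defs where

open import Data.Nat using (ℕ; suc; _+_)
open import Data.Fin using (Fin; zero; suc; splitAt; punchIn)
open import Data.Bool using (Bool; true; false; not)
open import Data.Sum using (_⊎_; inj₁; inj₂)
open import Data.Product using (_×_; ∃-syntax)
open import Relation.Binary.PropositionalEquality using (_≡_; _≢_)
open import Relation.Nullary using (¬_)

Digraph : ℕ → Set
Digraph n = Fin n → Fin n → Bool

record IsTournament {n : ℕ} (T : Digraph n) : Set where
  field
    loopless : ∀ a → T a a ≡ false
    oneEdge  : ∀ a b → a ≢ b → T b a ≡ not (T a b)

record InducedCopy {m n : ℕ} (S : Digraph m) (T : Digraph n) : Set where
  field
    f   : Fin m → Fin n
    inj : ∀ a b → f a ≡ f b → a ≡ b
    hom : ∀ a b → T (f a) (f b) ≡ S a b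

Free : {m n : ℕ} → Digraph m → Digraph n → Set
Free S T = ¬ InducedCopy S T

-- Δ(1,2,2): x = 0, y₁ = 1, y₂ = 2, z₁ = 3, z₂ = 4,
-- x ⇒ {y₁,y₂} ⇒ {z₁,z₂} ⇒ x, with edges y₁y₂ and z₁z₂.
Δ122 : Digraph 5
Δ122 zero (suc zero) = true
Δ122 zero (suc (suc zero)) = true
Δ122 (suc zero) (suc (suc zero)) = true
Δ122 (suc zero) (suc (suc (suc zero))) = true
Δ122 (suc zero) (suc (suc (suc (suc zero)))) = true
Δ122 (suc (suc zero)) (suc (suc (suc zero))) = true
Δ122 (suc (suc zero)) (suc (suc (suc (suc zero)))) = true
Δ122 (suc (suc (suc zero))) zero = true
Δ122 (suc (suc (suc zero))) (suc (suc (suc (suc zero)))) = true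
Δ122 (suc (suc (suc (suc zero)))) zero = true
Δ122 _ _ = false

CyclicTriangle : {n : ℕ} → Digraph n → Fin n → Fin n → Fin n → Set
CyclicTriangle T a b c =
  (T a b ≡ true × T b c ≡ true × T c a ≡ true) ⊎
  (T b a ≡ true × T c b ≡ true × T a c ≡ true)

Nice : {n : ℕ} → Digraph n → Fin n → Set
Nice T v = ¬ (∃[ x ] ∃[ y₁ ] ∃[ y₂ ]
  (x ≢ y₁ × x ≢ y₂ × y₁ ≢ y₂ ×
   CyclicTriangle T v x y₁ × CyclicTriangle T v x y₂))

-- The result has vertex set Fin (n + m): the first n vertices are the
-- vertices of T other than v (i ↦ punchIn v i), the last m those of S.
substitute : {n m : ℕ} → Digraph (suc n) → Fin (suc n) → Digraph m → Digraph (n + m)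
substitute {n} T v S a b with splitAt n a | splitAt n b
... | inj₁ i | inj₁ j = T (punchIn v i) (punchIn v j)
... | inj₁ i | inj₂ j = T (punchIn v i) v
... | inj₂ i | inj₁ j = T v (punchIn v j)
... | inj₂ i | inj₂ j = S i j

-- Let A be the set of vertices of a copy of Δ(1,2,2) in T[S/v] that lie in S.
-- Every other vertex sees all of S alike, so A is a homogeneous set of Δ(1,2,2),
-- and the only such sets are the whole vertex set, those of size at most one,
-- {y₁,y₂} and {z₁,z₂}.  So the copy lies in S, or collapsing S to v maps it onto a
-- copy in T, or the collapse exhibits cyclic triangles {v,x,z₁}, {v,x,z₂}
-- (resp. {v,x,y₁}, {v,x,y₂}) and v is not nice.  Conversely, two cyclic triangles
-- {v,x,y₁}, {v,x,y₂} orient vx alike, and blowing v up to an arc s → s′ of S yields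
-- a Δ(1,2,2) in which s, s′ play z₁, z₂ if v → x, and y₁, y₂ if x → v.
module Submission where

open import Defs
open import Data.Nat using (ℕ; suc; _≤_; _+_; s≤s)
open import Data.Bool using (true; false; not)
open import Data.Bool.Properties using () renaming (_≟_ to _≟ᵇ_)
open import Data.Fin using (Fin; suc; splitAt; punchIn; punchOut; _↑ˡ_; _↑ʳ_)
open import Data.Fin.Patterns using (0F; 1F; 2F; 3F; 4F)
open import Data.Fin.Properties
  using (all?; splitAt-↑ˡ; splitAt-↑ʳ; punchIn-punchOut) renaming (_≟_ to _≟ᶠ_)
open import Data.Fin.Subset using (Subset; Side; inside; outside; ⊤)
open import Data.Fin.Subset.Properties using (anySubset?)
open import Data.Vec using ([]; _∷_; lookup; tabulate)
open import Data.Vec.Properties using (≡-dec; lookup∘tabulate; lookup-replicate)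
open import Data.Sum using (_⊎_; inj₁; inj₂; [_,_]′)
import Data.Sum as Sum
open import Data.Product using (_×_; _,_; ∃-syntax)
open import Function using (_∘_; const; case_of_)
open import Function.Bundles using (_⇔_; mk⇔)
open import Relation.Binary.PropositionalEquality
open import Relation.Nullary using (Dec; ¬_; ¬?; yes; no)
open import Relation.Nullary.Decidable
  using (_×-dec_; _⊎-dec_; _→-dec_; from-yes; from-no; decidable-stable)

IsOriented : {k : ℕ} → Digraph k → Set
IsOriented G = ∀ a b → G a b ≡ true → G b a ≡ false

oriented-loopless : {k : ℕ} {G : Digraph k} → IsOriented G → ∀ a → G a a ≡ false
oriented-loopless {G = G} G-oriented a with G a a in aa
... | true with () ← trans (sym aa) (G-oriented a a aa)
... | false = refl

module _ {k : ℕ} {G : Digraph k} (G-tournament : IsTournament G) where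
  open IsTournament G-tournament

  arc⇒≢ : ∀ {a b} → G a b ≡ true → a ≢ b
  arc⇒≢ {a} ab refl with () ← trans (sym (loopless a)) ab

  tournament-oriented : IsOriented G
  tournament-oriented a b ab = trans (oneEdge a b (arc⇒≢ ab)) (cong not ab)

  arc-total : ∀ {a b} → a ≢ b → G a b ≡ true ⊎ G b a ≡ true
  arc-total {a} {b} a≢b with G a b in ab
  ... | true  = inj₁ refl
  ... | false = inj₂ (trans (oneEdge a b a≢b) (cong not ab))

tournament-arc : {m : ℕ} {S : Digraph m} → IsTournament S → 2 ≤ m →
                 ∃[ s ] ∃[ s′ ] S s s′ ≡ true
tournament-arc S-tournament (s≤s (s≤s _)) with arc-total S-tournament {0F} {1F} (λ ())
... | inj₁ arc = 0F , 1F , arc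
... | inj₂ arc = 1F , 0F , arc

copy-from-hom : {j k : ℕ} {P : Digraph j} {G : Digraph k} → IsTournament P →
                (f : Fin j → Fin k) → (∀ a b → G (f a) (f b) ≡ P a b) → InducedCopy P G
copy-from-hom {P = P} {G} P-tournament f hom = record { f = f ; inj = inj ; hom = hom }
  where
  open ≡-Reasoning

  merged⇒no-arc : ∀ {a b} → f a ≡ f b → P a b ≡ false
  merged⇒no-arc {a} {b} fa≡fb = begin
    P a b          ≡⟨ sym (hom a b) ⟩
    G (f a) (f b)  ≡⟨ cong (G (f a)) (sym fa≡fb) ⟩
    G (f a) (f a)  ≡⟨ hom a a ⟩
    P a a          ≡⟨ IsTournament.loopless P-tournament a ⟩
    false          ∎

  inj : ∀ a b → f a ≡ f b → a ≡ b
  inj a b fa≡fb with a ≟ᶠ b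
  ... | yes a≡b = a≡b
  ... | no a≢b with arc-total P-tournament a≢b
  ...   | inj₁ ab with () ← trans (sym ab) (merged⇒no-arc fa≡fb)
  ...   | inj₂ ba with () ← trans (sym ba) (merged⇒no-arc (sym fa≡fb))

copy-from-arcs : {j k : ℕ} {P : Digraph j} {G : Digraph k} → IsTournament P → IsOriented G →
                 (f : Fin j → Fin k) → (∀ a b → P a b ≡ true → G (f a) (f b) ≡ true) →
                 InducedCopy P G
copy-from-arcs {P = P} {G} P-tournament G-oriented f arcs = copy-from-hom P-tournament f hom
  where
  hom : ∀ a b → G (f a) (f b) ≡ P a b
  hom a b with P a b in ab
  ... | true = arcs a b ab
  ... | false with a ≟ᶠ b
  ...   | yes refl = oriented-loopless G-oriented (f a)
  ...   | no a≢b = G-oriented (f b) (f a) (arcs b a ba)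
    where
    ba : P b a ≡ true
    ba = trans (IsTournament.oneEdge P-tournament a b a≢b) (cong not ab)

Δ122-tournament : IsTournament Δ122
Δ122-tournament = record
  { loopless = λ { 0F → refl ; 1F → refl ; 2F → refl ; 3F → refl ; 4F → refl }
  ; oneEdge  = from-yes (all? λ a → all? λ b →
                 ¬? (a ≟ᶠ b) →-dec (Δ122 b a ≟ᵇ not (Δ122 a b)))
  }

Δ122-copy : {k : ℕ} {G : Digraph k} → IsOriented G → {x y₁ y₂ z₁ z₂ : Fin k} →
            G x y₁ ≡ true → G x y₂ ≡ true → G y₁ y₂ ≡ true →
            G y₁ z₁ ≡ true → G y₁ z₂ ≡ true →
            G y₂ z₁ ≡ true → G y₂ z₂ ≡ true →
            G z₁ z₂ ≡ true → G z₁ x ≡ true → G z₂ x ≡ true → InducedCopy Δ122 G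
Δ122-copy {k} {G} G-oriented {x} {y₁} {y₂} {z₁} {z₂}
          xy₁ xy₂ y₁y₂ y₁z₁ y₁z₂ y₂z₁ y₂z₂ z₁z₂ z₁x z₂x =
  copy-from-arcs Δ122-tournament G-oriented w arcs
  where
  w : Fin 5 → Fin k
  w = lookup (x ∷ y₁ ∷ y₂ ∷ z₁ ∷ z₂ ∷ [])

  arcs : ∀ a b → Δ122 a b ≡ true → G (w a) (w b) ≡ true
  arcs 0F 0F ()
  arcs 0F 1F _ = xy₁
  arcs 0F 2F _ = xy₂
  arcs 0F (suc (suc (suc _))) ()
  arcs 1F 0F ()
  arcs 1F 1F ()
  arcs 1F 2F _ = y₁y₂
  arcs 1F 3F _ = y₁z₁
  arcs 1F 4F _ = y₁z₂
  arcs 2F 0F ()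
  arcs 2F 1F ()
  arcs 2F 2F ()
  arcs 2F 3F _ = y₂z₁
  arcs 2F 4F _ = y₂z₂
  arcs 3F 0F _ = z₁x
  arcs 3F 1F ()
  arcs 3F 2F ()
  arcs 3F 3F ()
  arcs 3F 4F _ = z₁z₂
  arcs 4F 0F _ = z₂x
  arcs 4F (suc _) ()

Homogeneous : {k : ℕ} → Digraph k → Subset k → Set
Homogeneous G p = ∀ a b c → lookup p a ≡ inside → lookup p b ≡ inside →
                  lookup p c ≡ outside → G c a ≡ G c b

homogeneous? : {k : ℕ} (G : Digraph k) (p : Subset k) → Dec (Homogeneous G p)
homogeneous? G p = all? λ a → all? λ b → all? λ c →
  (lookup p a ≟ᵇ inside) →-dec (lookup p b ≟ᵇ inside) →-dec
  (lookup p c ≟ᵇ outside) →-dec (G c a ≟ᵇ G c b)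

Subsingleton : {k : ℕ} → Subset k → Set
Subsingleton p = ∀ a b → lookup p a ≡ inside → lookup p b ≡ inside → a ≡ b

subsingleton? : {k : ℕ} (p : Subset k) → Dec (Subsingleton p)
subsingleton? p = all? λ a → all? λ b →
  (lookup p a ≟ᵇ inside) →-dec (lookup p b ≟ᵇ inside) →-dec (a ≟ᶠ b)

Ys Zs : Subset 5
Ys = outside ∷ inside ∷ inside ∷ outside ∷ outside ∷ []
Zs = outside ∷ outside ∷ outside ∷ inside ∷ inside ∷ []

Δ122-Homogeneous-Shape : Subset 5 → Set
Δ122-Homogeneous-Shape p = p ≡ ⊤ ⊎ Subsingleton p ⊎ p ≡ Ys ⊎ p ≡ Zs

Δ122-homogeneous-shape? : (p : Subset 5) → Dec (Δ122-Homogeneous-Shape p)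
Δ122-homogeneous-shape? p =
  p ≟ˢ ⊤ ⊎-dec subsingleton? p ⊎-dec p ≟ˢ Ys ⊎-dec p ≟ˢ Zs
  where
  _≟ˢ_ : (p q : Subset 5) → Dec (p ≡ q)
  _≟ˢ_ = ≡-dec _≟ᵇ_

Δ122-homogeneous : (p : Subset 5) → Homogeneous Δ122 p → Δ122-Homogeneous-Shape p
Δ122-homogeneous p p-homogeneous = decidable-stable (Δ122-homogeneous-shape? p) λ ¬shape →
  from-no (anySubset? λ q → homogeneous? Δ122 q ×-dec ¬? (Δ122-homogeneous-shape? q))
          (p , p-homogeneous , ¬shape)

module Substitution {n m : ℕ} (T : Digraph (suc n)) (v : Fin (suc n)) (S : Digraph m) where

  T′ : Digraph (n + m)
  T′ = substitute T v S

  side : Fin (n + m) → Side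
  side u = [ const outside , const inside ]′ (splitAt n u)

  contract : Fin (n + m) → Fin (suc n)
  contract u = [ punchIn v , const v ]′ (splitAt n u)

  S-vertex : (u : Fin (n + m)) → side u ≡ inside → Fin m
  S-vertex u u-inside with splitAt n u
  ... | inj₂ j = j

  substitute-oriented : IsOriented T → IsOriented S → IsOriented T′
  substitute-oriented T-oriented S-oriented u w with splitAt n u | splitAt n w
  ... | inj₁ _ | inj₁ _ = T-oriented _ _
  ... | inj₁ _ | inj₂ _ = T-oriented _ _
  ... | inj₂ _ | inj₁ _ = T-oriented _ _
  ... | inj₂ _ | inj₂ _ = S-oriented _ _

  contract-inside : ∀ u → side u ≡ inside → contract u ≡ v
  contract-inside u u-inside with splitAt n u
  ... | inj₂ _ = refl

  T′-contract : ∀ u w → side u ≡ outside ⊎ side w ≡ outside →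
                T′ u w ≡ T (contract u) (contract w)
  T′-contract u w outside-S with splitAt n u | splitAt n w
  ... | inj₁ _ | inj₁ _ = refl
  ... | inj₁ _ | inj₂ _ = refl
  ... | inj₂ _ | inj₁ _ = refl
  ... | inj₂ _ | inj₂ _ with outside-S
  ...   | inj₁ ()
  ...   | inj₂ ()

  T′-S-vertex : ∀ u w (u-inside : side u ≡ inside) (w-inside : side w ≡ inside) →
                T′ u w ≡ S (S-vertex u u-inside) (S-vertex w w-inside)
  T′-S-vertex u w u-inside w-inside with splitAt n u | splitAt n w
  ... | inj₂ _ | inj₂ _ = refl

  outer : ∀ {x} → v ≢ x → Fin (n + m)
  outer v≢x = punchOut v≢x ↑ˡ m

  inner : Fin m → Fin (n + m)
  inner j = n ↑ʳ j

  T′-outer-outer : ∀ {x y} (v≢x : v ≢ x) (v≢y : v ≢ y) →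
                   T′ (outer v≢x) (outer v≢y) ≡ T x y
  T′-outer-outer v≢x v≢y
    rewrite splitAt-↑ˡ n (punchOut v≢x) m | splitAt-↑ˡ n (punchOut v≢y) m
          | punchIn-punchOut v≢x | punchIn-punchOut v≢y = refl

  T′-outer-inner : ∀ {x} (v≢x : v ≢ x) j → T′ (outer v≢x) (inner j) ≡ T x v
  T′-outer-inner v≢x j
    rewrite splitAt-↑ˡ n (punchOut v≢x) m | splitAt-↑ʳ n m j | punchIn-punchOut v≢x = refl

  T′-inner-outer : ∀ {x} j (v≢x : v ≢ x) → T′ (inner j) (outer v≢x) ≡ T v x
  T′-inner-outer j v≢x
    rewrite splitAt-↑ʳ n m j | splitAt-↑ˡ n (punchOut v≢x) m | punchIn-punchOut v≢x = refl

  T′-inner-inner : ∀ i j → T′ (inner i) (inner j) ≡ S i j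
  T′-inner-inner i j rewrite splitAt-↑ʳ n m i | splitAt-↑ʳ n m j = refl

  module _ (T-tournament : IsTournament T) (S-oriented : IsOriented S)
           {s s′ : Fin m} (ss′ : S s s′ ≡ true) where

    T-oriented : IsOriented T
    T-oriented = tournament-oriented T-tournament

    T′-oriented : IsOriented T′
    T′-oriented = substitute-oriented T-oriented S-oriented

    triangle-avoids-v : ∀ {x y} → CyclicTriangle T v x y → v ≢ x × v ≢ y
    triangle-avoids-v (inj₁ (vx , _ , yv)) =
      arc⇒≢ T-tournament vx , ≢-sym (arc⇒≢ T-tournament yv)
    triangle-avoids-v (inj₂ (xv , _ , vy)) =
      ≢-sym (arc⇒≢ T-tournament xv) , arc⇒≢ T-tournament vy

    copy-from-ordered-triangles : ∀ {x y₁ y₂} → v ≢ x → v ≢ y₁ → v ≢ y₂ →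
      T y₁ y₂ ≡ true → CyclicTriangle T v x y₁ → CyclicTriangle T v x y₂ →
      InducedCopy Δ122 T′
    copy-from-ordered-triangles v≢x v≢y₁ v≢y₂ y₁y₂
                                (inj₁ (vx , xy₁ , y₁v)) (inj₁ (_ , xy₂ , y₂v)) =
      Δ122-copy T′-oriented
        (trans (T′-outer-outer v≢x v≢y₁) xy₁) (trans (T′-outer-outer v≢x v≢y₂) xy₂)
        (trans (T′-outer-outer v≢y₁ v≢y₂) y₁y₂)
        (trans (T′-outer-inner v≢y₁ s) y₁v) (trans (T′-outer-inner v≢y₁ s′) y₁v)
        (trans (T′-outer-inner v≢y₂ s) y₂v) (trans (T′-outer-inner v≢y₂ s′) y₂v)
        (trans (T′-inner-inner s s′) ss′)
        (trans (T′-inner-outer s v≢x) vx) (trans (T′-inner-outer s′ v≢x) vx)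
    copy-from-ordered-triangles v≢x v≢y₁ v≢y₂ y₁y₂
                                (inj₂ (xv , y₁x , vy₁)) (inj₂ (_ , y₂x , vy₂)) =
      Δ122-copy T′-oriented
        (trans (T′-outer-inner v≢x s) xv) (trans (T′-outer-inner v≢x s′) xv)
        (trans (T′-inner-inner s s′) ss′)
        (trans (T′-inner-outer s v≢y₁) vy₁) (trans (T′-inner-outer s v≢y₂) vy₂)
        (trans (T′-inner-outer s′ v≢y₁) vy₁) (trans (T′-inner-outer s′ v≢y₂) vy₂)
        (trans (T′-outer-outer v≢y₁ v≢y₂) y₁y₂)
        (trans (T′-outer-outer v≢y₁ v≢x) y₁x) (trans (T′-outer-outer v≢y₂ v≢x) y₂x)
    copy-from-ordered-triangles _ _ _ _ (inj₁ (vx , _)) (inj₂ (xv , _))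
      with () ← trans (sym xv) (T-oriented _ _ vx)
    copy-from-ordered-triangles _ _ _ _ (inj₂ (xv , _)) (inj₁ (vx , _))
      with () ← trans (sym xv) (T-oriented _ _ vx)

    copy-from-triangles : ∀ {x y₁ y₂} → y₁ ≢ y₂ →
      CyclicTriangle T v x y₁ → CyclicTriangle T v x y₂ → InducedCopy Δ122 T′
    copy-from-triangles y₁≢y₂ t₁ t₂ with triangle-avoids-v t₁ | triangle-avoids-v t₂
    ... | v≢x , v≢y₁ | _ , v≢y₂ with arc-total T-tournament y₁≢y₂
    ...   | inj₁ y₁y₂ = copy-from-ordered-triangles v≢x v≢y₁ v≢y₂ y₁y₂ t₁ t₂
    ...   | inj₂ y₂y₁ = copy-from-ordered-triangles v≢x v≢y₂ v≢y₁ y₂y₁ t₂ t₁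

    free⇒nice : Free Δ122 T′ → Nice T v
    free⇒nice T′-free (_ , _ , _ , _ , _ , y₁≢y₂ , t₁ , t₂) =
      T′-free (copy-from-triangles y₁≢y₂ t₁ t₂)

  module Contraction (T-tournament : IsTournament T) (copy : InducedCopy Δ122 T′) where
    open InducedCopy copy using (f; hom)
    open ≡-Reasoning

    A : Subset 5
    A = tabulate (side ∘ f)

    _∈A _∉A : Fin 5 → Set
    a ∈A = lookup A a ≡ inside
    a ∉A = lookup A a ≡ outside

    side-f : ∀ a → side (f a) ≡ lookup A a
    side-f a = sym (lookup∘tabulate (side ∘ f) a)

    g : Fin 5 → Fin (suc n)
    g = contract ∘ f

    g-inside : ∀ {a} → a ∈A → g a ≡ v
    g-inside {a} a∈A = contract-inside (f a) (trans (side-f a) a∈A)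

    g-hom : ∀ {a b} → a ∉A ⊎ b ∉A → T (g a) (g b) ≡ Δ122 a b
    g-hom {a} {b} a∉A⊎b∉A = begin
      T (g a) (g b)  ≡⟨ T′-contract (f a) (f b) f-outside ⟨
      T′ (f a) (f b) ≡⟨ hom a b ⟩
      Δ122 a b       ∎
      where
      f-outside : side (f a) ≡ outside ⊎ side (f b) ≡ outside
      f-outside = Sum.map (trans (side-f a)) (trans (side-f b)) a∉A⊎b∉A

    A-homogeneous : Homogeneous Δ122 A
    A-homogeneous a b c a∈A b∈A c∉A = begin
      Δ122 c a       ≡⟨ g-hom (inj₁ c∉A) ⟨
      T (g c) (g a)  ≡⟨ cong (T (g c)) (trans (g-inside a∈A) (sym (g-inside b∈A))) ⟩
      T (g c) (g b)  ≡⟨ g-hom (inj₁ c∉A) ⟩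
      Δ122 c b       ∎

    copy-in-S : A ≡ ⊤ → InducedCopy Δ122 S
    copy-in-S A≡⊤ = copy-from-hom Δ122-tournament (λ a → S-vertex (f a) (f-inside a)) S-hom
      where
      f-inside : ∀ a → side (f a) ≡ inside
      f-inside a = trans (side-f a)
                         (trans (cong (λ p → lookup p a) A≡⊤) (lookup-replicate a inside))

      S-hom : ∀ a b → S (S-vertex (f a) (f-inside a)) (S-vertex (f b) (f-inside b)) ≡ Δ122 a b
      S-hom a b = trans (sym (T′-S-vertex (f a) (f b) (f-inside a) (f-inside b))) (hom a b)

    copy-in-T : Subsingleton A → InducedCopy Δ122 T
    copy-in-T A-subsingleton = copy-from-hom Δ122-tournament g g-hom′
      where
      g-hom′ : ∀ a b → T (g a) (g b) ≡ Δ122 a b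
      g-hom′ a b with lookup A a in a∈?A | lookup A b in b∈?A
      ... | outside | _       = g-hom (inj₁ a∈?A)
      ... | inside  | outside = g-hom (inj₂ b∈?A)
      ... | inside  | inside  rewrite A-subsingleton a b a∈?A b∈?A =
        trans (IsTournament.loopless T-tournament (g b))
              (sym (IsTournament.loopless Δ122-tournament b))

    g-arc : ∀ a b → a ∉A ⊎ b ∉A → Δ122 a b ≡ true → T (g a) (g b) ≡ true
    g-arc a b a∉A⊎b∉A ab = trans (g-hom a∉A⊎b∉A) ab

    g-≢ : ∀ a b → a ∉A ⊎ b ∉A → Δ122 a b ≡ true → g a ≢ g b
    g-≢ a b a∉A⊎b∉A ab = arc⇒≢ T-tournament (g-arc a b a∉A⊎b∉A ab)

    arc-to-v : ∀ a b → a ∉A → b ∈A → Δ122 a b ≡ true → T (g a) v ≡ true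
    arc-to-v a b a∉A b∈A ab =
      subst (λ w → T (g a) w ≡ true) (g-inside b∈A) (g-arc a b (inj₁ a∉A) ab)

    arc-from-v : ∀ a b → a ∈A → b ∉A → Δ122 a b ≡ true → T v (g b) ≡ true
    arc-from-v a b a∈A b∉A ab =
      subst (λ w → T w (g b) ≡ true) (g-inside a∈A) (g-arc a b (inj₂ b∉A) ab)

    not-nice-Ys : A ≡ Ys → ¬ Nice T v
    not-nice-Ys A≡Ys nice = nice
      (g 0F , g 3F , g 4F ,
       ≢-sym (g-≢ 3F 0F (inj₁ (A-at 3F)) refl) , ≢-sym (g-≢ 4F 0F (inj₁ (A-at 4F)) refl) ,
       g-≢ 3F 4F (inj₁ (A-at 3F)) refl ,
       triangle 3F (A-at 3F) refl refl , triangle 4F (A-at 4F) refl refl)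
      where
      A-at : ∀ a → lookup A a ≡ lookup Ys a
      A-at a = cong (λ p → lookup p a) A≡Ys

      triangle : ∀ z → z ∉A → Δ122 z 0F ≡ true → Δ122 1F z ≡ true →
                 CyclicTriangle T v (g 0F) (g z)
      triangle z z∉A zx yz = inj₂ ( arc-to-v 0F 1F (A-at 0F) (A-at 1F) refl
                                  , g-arc z 0F (inj₁ z∉A) zx
                                  , arc-from-v 1F z (A-at 1F) z∉A yz )

    not-nice-Zs : A ≡ Zs → ¬ Nice T v
    not-nice-Zs A≡Zs nice = nice
      (g 0F , g 1F , g 2F ,
       g-≢ 0F 1F (inj₁ (A-at 0F)) refl , g-≢ 0F 2F (inj₁ (A-at 0F)) refl ,
       g-≢ 1F 2F (inj₁ (A-at 1F)) refl ,
       triangle 1F (A-at 1F) refl refl , triangle 2F (A-at 2F) refl refl)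
      where
      A-at : ∀ a → lookup A a ≡ lookup Zs a
      A-at a = cong (λ p → lookup p a) A≡Zs

      triangle : ∀ y → y ∉A → Δ122 0F y ≡ true → Δ122 y 3F ≡ true →
                 CyclicTriangle T v (g 0F) (g y)
      triangle y y∉A xy yz = inj₁ ( arc-from-v 3F 0F (A-at 3F) (A-at 0F) refl
                                  , g-arc 0F y (inj₁ (A-at 0F)) xy
                                  , arc-to-v y 3F y∉A (A-at 3F) yz )

  nice⇒free : IsTournament T → Free Δ122 T → Free Δ122 S → Nice T v → Free Δ122 T′
  nice⇒free T-tournament T-free S-free nice copy =
    case Δ122-homogeneous A A-homogeneous of λ where
      (inj₁ A≡⊤)                   → S-free (copy-in-S A≡⊤)
      (inj₂ (inj₁ A-subsingleton)) → T-free (copy-in-T A-subsingleton)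
      (inj₂ (inj₂ (inj₁ A≡Ys)))    → not-nice-Ys A≡Ys nice
      (inj₂ (inj₂ (inj₂ A≡Zs)))    → not-nice-Zs A≡Zs nice
    where open Contraction T-tournament copy

lemma3p4 : {n m : ℕ} (T : Digraph (suc n)) (S : Digraph m) (v : Fin (suc n)) →
           IsTournament T → Free Δ122 T →
           IsTournament S → Free Δ122 S → 2 ≤ m →
           (Free Δ122 (substitute T v S) ⇔ Nice T v)
lemma3p4 T S v T-tournament T-free S-tournament S-free 2≤m with tournament-arc S-tournament 2≤m
... | _ , _ , ss′ = mk⇔ (free⇒nice T-tournament (tournament-oriented S-tournament) ss′)
                       (nice⇒free T-tournament T-free S-free)
  where open Substitution T v S
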